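{- Let $p$ and $\ell$ be distinct prime numbers. If $\ell-1$ divides $p-1$, then $\gamma_p(\mathbb{Q})\subseteq\ell\mathbb{Z}_{(\ell)}$.
   Context: $\gamma_p(X)=\frac1p\cdot\frac{X^p-X}{(X^p-X)^2-1}$ and $\gamma_p(\mathbb{Q})$ is the set of values $\gamma_p(x)$ for $x\in\mathbb{Q}$ not a pole of $\gamma_p$; $\mathbb{Z}_{(\ell)}$ is the localization of $\mathbb{Z}$ at $\ell$. -}

module Defs where

open import Data.Nat as ℕ using (ℕ; zero; suc; NonZero)
open import Data.Nat.Divisibility using (_∣_)
open import Data.Nat.Primality using (Prime; prime⇒nonZero)
open import Data.Integer as ℤ using (ℤ; +_)
open import Data.Rational as ℚ using (ℚ; _/_; _*_; _-_; _÷_; 0ℚ; 1ℚ; ≢-nonZero)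
open import Data.Product using (Σ; _×_)
open import Relation.Nullary using (¬_)
open import Relation.Binary.PropositionalEquality using (_≡_; _≢_)

_^ℚ_ : ℚ → ℕ → ℚ
x ^ℚ zero  = 1ℚ
x ^ℚ suc n = x * (x ^ℚ n)

numγ : ℕ → ℚ → ℚ
numγ p x = (x ^ℚ p) - x

denγ : ℕ → ℚ → ℚ
denγ p x = (numγ p x * numγ p x) - 1ℚ

γ : (p : ℕ) → Prime p → (x : ℚ) → denγ p x ≢ 0ℚ → ℚ
γ p pp x h =
  _/_ (+ 1) p {{prime⇒nonZero pp}} * _÷_ (numγ p x) (denγ p x) {{≢-nonZero h}}

InZloc : ℕ → ℚ → Set
InZloc ℓ q = Σ ℤ λ a → Σ ℕ λ b → Σ (NonZero b) λ nz →
  (¬ (ℓ ∣ b)) × (q ≡ _/_ a b {{nz}})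

InℓZloc : ℕ → ℚ → Set
InℓZloc ℓ q = Σ ℚ λ r → InZloc ℓ r × (q ≡ ((+ ℓ) / 1) * r)

-- Write x = n / d in lowest terms and put N = n^p - n d^(p-1), D = d^p and E = N² - D², so that
-- γ_p(x) = N D / (p E). Since ℓ - 1 ∣ p - 1, iterating Fermat's little theorem gives a^p ≡ a (mod ℓ)
-- for every integer a; hence N d = (n^p - n) d - n (d^p - d) ≡ 0 and ℓ ∣ N D. Moreover ℓ ∤ p E:
-- if ℓ ∤ d then ℓ ∣ N and E ≡ -D² ≢ 0, while if ℓ ∣ d then ℓ ∤ n and E ≡ N² ≡ n^(2p) ≢ 0 (mod ℓ).
-- So γ_p(x) = ℓ · k / (p E) with k ∈ ℤ and p E a unit of ℤ_(ℓ).
module Submission where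

open import Defs
open import Data.Nat using (ℕ; _∸_)
open import Data.Nat.Divisibility using (_∣_)
open import Data.Nat.Primality using (Prime)
open import Data.Rational using (ℚ; 0ℚ)
open import Relation.Binary.PropositionalEquality using (_≢_)

module FermatNat where

  open import Data.Nat
  open import Data.Nat.Properties
  open import Data.Nat.Divisibility
  open import Data.Nat.DivMod using (m/n*n≡m)
  open import Data.Nat.Primality
  open import Data.Nat.Combinatorics using (_C_; nCk≡n!/k![n-k]!; nCn≡1; k![n∸k]!∣n!)
  open import Data.Nat.Tactic.RingSolver using (solve-∀)
  open import Data.Fin using (zero; suc; toℕ; fromℕ; inject₁)
  open import Data.Fin.Properties using (toℕ-fromℕ; toℕ-inject₁; toℕ<n)
  open import Data.Vec.Functional using (Vector; init; tail)
  open import Data.Product using (∃-syntax; _×_; _,_)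
  open import Data.Sum using (inj₁; inj₂)
  open import Function using (_∘_)
  open import Relation.Nullary using (¬_; contradiction)
  open import Relation.Binary.PropositionalEquality
  open import Algebra.Properties.Monoid.Sum +-0-monoid using (sum; sum-init-last)
  import Algebra.Properties.CommutativeSemiring.Binomial +-*-commutativeSemiring as Binomial
  import Algebra.Properties.Semiring.Exp +-*-semiring as Semiring
  import Algebra.Definitions.RawMonoid +-0-rawMonoid as Monoid

  ×≡* : ∀ n x → n Monoid.× x ≡ n * x
  ×≡* zero    x = refl
  ×≡* (suc n) x = cong (x +_) (×≡* n x)

  ^≡^ : ∀ x n → x Semiring.^ n ≡ x ^ n
  ^≡^ x zero    = refl
  ^≡^ x (suc n) = cong (x *_) (^≡^ x n)

  prime∤! : ∀ {p} → Prime p → ∀ m → m < p → ¬ p ∣ m !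
  prime∤! pp zero    _   p∣1  = ¬prime[1] (subst Prime (∣1⇒≡1 p∣1) pp)
  prime∤! pp (suc m) m<p p∣m! with euclidsLemma (suc m) (m !) pp p∣m!
  ... | inj₁ p∣1+m = <⇒≱ m<p (∣⇒≤ p∣1+m)
  ... | inj₂ p∣m!  = prime∤! pp m (<-trans (n<1+n m) m<p) p∣m!

  prime∣pCk : ∀ {p k} → Prime p → 0 < k → k < p → p ∣ p C k
  prime∣pCk {suc m} {k} pp 0<k k<p with euclidsLemma (suc m C k) (k ! * (suc m ∸ k) !) pp p∣pCk*k!*[p∸k]!
    where
    instance _ = k !* (suc m ∸ k) !≢0
    pCk*k!*[p∸k]!≡p! : (suc m C k) * (k ! * (suc m ∸ k) !) ≡ suc m !
    pCk*k!*[p∸k]!≡p! = trans (cong (_* (k ! * (suc m ∸ k) !)) (nCk≡n!/k![n-k]! (<⇒≤ k<p)))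
                             (m/n*n≡m (k![n∸k]!∣n! (<⇒≤ k<p)))
    p∣pCk*k!*[p∸k]! : suc m ∣ (suc m C k) * (k ! * (suc m ∸ k) !)
    p∣pCk*k!*[p∸k]! = subst (suc m ∣_) (sym pCk*k!*[p∸k]!≡p!) (m∣m*n (m !))
  ... | inj₁ p∣pCk = p∣pCk
  ... | inj₂ p∣k!*[p∸k]! with euclidsLemma (k !) ((suc m ∸ k) !) pp p∣k!*[p∸k]!
  ...   | inj₁ p∣k!      = contradiction p∣k! (prime∤! pp k k<p)
  ...   | inj₂ p∣[p∸k]! = contradiction p∣[p∸k]! (prime∤! pp (suc m ∸ k) (∸-monoʳ-< 0<k (<⇒≤ k<p)))

  prime∤prime : ∀ {ℓ p} → Prime ℓ → Prime p → ℓ ≢ p → ¬ (ℓ ∣ p)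
  prime∤prime pℓ pp ℓ≢p ℓ∣p with prime⇒irreducible pp ℓ∣p
  ... | inj₁ ℓ≡1 = ¬prime[1] (subst Prime ℓ≡1 pℓ)
  ... | inj₂ ℓ≡p = ℓ≢p ℓ≡p

  ∣-sum : ∀ {d n} (t : Vector ℕ n) → (∀ i → d ∣ t i) → d ∣ sum t
  ∣-sum {d} {zero}  t _       = d ∣0
  ∣-sum {d} {suc n} t d∣t[_] = ∣m∣n⇒∣m+n d∣t[ zero ] (∣-sum (tail t) (d∣t[_] ∘ suc))

  -- Congruences in ℕ are written x ≡ y + m with p ∣ m, avoiding truncated subtraction.
  freshmansDream : ∀ {p} → Prime p → ∀ a → ∃[ m ] p ∣ m × suc a ^ p ≡ a ^ p + (m + 1)
  freshmansDream {suc k} pp a = m , ∣-sum (init (tail T)) p∣middle , (begin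
    suc a ^ p                   ≡⟨ ^≡^ (suc a) p ⟨
    (1 + a) Semiring.^ p        ≡⟨ Binomial.theorem p 1 a ⟩
    T zero + sum (tail T)       ≡⟨ cong (T zero +_) (sum-init-last (tail T)) ⟩
    T zero + (m + T (fromℕ p))  ≡⟨ cong₂ (λ u v → u + (m + v)) T₀≡a^p Tₚ≡1 ⟩
    a ^ p + (m + 1)             ∎)
    where
    open ≡-Reasoning
    p : ℕ
    p = suc k
    T : Vector ℕ (suc p)
    T = Binomial.binomialTerm 1 a p
    m : ℕ
    m = sum (init (tail T))
    T₀≡a^p : T zero ≡ a ^ p
    T₀≡a^p = trans (+-identityʳ _) (trans (*-identityˡ (a Semiring.^ p)) (^≡^ a p))
    Tₚ≡1 : T (fromℕ p) ≡ 1
    Tₚ≡1 = begin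
      T (fromℕ p)
        ≡⟨ ×≡* (p C toℕ (fromℕ p)) _ ⟩
      (p C toℕ (fromℕ p)) * (1 Semiring.^ toℕ (fromℕ p) * a Semiring.^ (p ∸ toℕ (fromℕ p)))
        ≡⟨ cong (λ i → (p C i) * (1 Semiring.^ i * a Semiring.^ (p ∸ i))) (toℕ-fromℕ p) ⟩
      (p C p) * (1 Semiring.^ p * a Semiring.^ (p ∸ p))
        ≡⟨ cong₂ (λ c i → c * (1 Semiring.^ p * a Semiring.^ i)) (nCn≡1 p) (n∸n≡0 p) ⟩
      1 * (1 Semiring.^ p * 1)
        ≡⟨ trans (*-identityˡ _) (*-identityʳ _) ⟩
      1 Semiring.^ p
        ≡⟨ trans (^≡^ 1 p) (^-zeroˡ p) ⟩
      1 ∎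
    p∣middle : ∀ j → p ∣ T (suc (inject₁ j))
    p∣middle j = subst (p ∣_) (sym (×≡* (p C i) _)) (∣m⇒∣m*n _ (prime∣pCk pp (s≤s z≤n) i<p))
      where
      i : ℕ
      i = toℕ (suc (inject₁ j))
      i<p : i < p
      i<p = s≤s (subst (_< k) (sym (toℕ-inject₁ j)) (toℕ<n j))

  fermatsLittleTheorem-ℕ : ∀ {p} → Prime p → ∀ a → ∃[ m ] p ∣ m × a ^ p ≡ m + a
  fermatsLittleTheorem-ℕ {suc k} pp zero    = 0 , suc k ∣0 , refl
  fermatsLittleTheorem-ℕ {p}     pp (suc a) with freshmansDream pp a | fermatsLittleTheorem-ℕ pp a
  ... | m₁ , p∣m₁ , [1+a]^p≡ | m₂ , p∣m₂ , a^p≡ = m₁ + m₂ , ∣m∣n⇒∣m+n p∣m₁ p∣m₂ , (begin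
    suc a ^ p              ≡⟨ [1+a]^p≡ ⟩
    a ^ p + (m₁ + 1)       ≡⟨ cong (_+ (m₁ + 1)) a^p≡ ⟩
    (m₂ + a) + (m₁ + 1)    ≡⟨ regroup m₁ m₂ a ⟩
    (m₁ + m₂) + (1 + a)    ∎)
    where
    open ≡-Reasoning
    regroup : ∀ m₁ m₂ a → (m₂ + a) + (m₁ + 1) ≡ (m₁ + m₂) + (1 + a)
    regroup = solve-∀

module FermatInt where

  open import Data.Nat as ℕ using (zero; suc)
  import Data.Nat.Divisibility as ℕ
  open import Data.Nat.Primality using (euclidsLemma; ¬prime[1]; prime⇒nonZero)
  open import Data.Integer using (ℤ; +_; _+_; _-_; _*_; _^_; ∣_∣; 0ℤ; 1ℤ)
  open import Data.Integer.Properties using (pos-+; pos-*; *-zeroˡ; ^-distribˡ-+-*; abs-*)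
  open import Data.Integer.Divisibility.Signed
    using (divides; ∣-refl; ∣-trans; ∣m∣n⇒∣m+n; ∣m∣n⇒∣m-n; ∣m⇒∣m*n; ∣n⇒∣m*n; ∣⇒∣ᵤ; ∣ᵤ⇒∣)
    renaming (_∣_ to _∣ᶻ_)
  open import Data.Integer.DivMod using (_%ℕ_; _/ℕ_; a≡a%ℕn+[a/ℕn]*n)
  open import Data.Integer.Tactic.RingSolver using (solve-∀)
  open import Data.Product using (_,_)
  open import Data.Sum using (_⊎_; [_,_]′; map)
  open import Data.Empty using (⊥-elim)
  open import Function using (id)
  open import Relation.Binary.PropositionalEquality
  open FermatNat using (fermatsLittleTheorem-ℕ)

  pos-^ : ∀ a k → + (a ℕ.^ k) ≡ (+ a) ^ k
  pos-^ a zero    = refl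
  pos-^ a (suc k) = trans (pos-* a (a ℕ.^ k)) (cong (+ a *_) (pos-^ a k))

  x-y∣x^k-y^k : ∀ x y k → x - y ∣ᶻ x ^ k - y ^ k
  x-y∣x^k-y^k x y zero    = divides 0ℤ (sym (*-zeroˡ (x - y)))
  x-y∣x^k-y^k x y (suc k) = subst (x - y ∣ᶻ_) (expand x y (x ^ k) (y ^ k))
    (∣m∣n⇒∣m+n (∣n⇒∣m*n x (x-y∣x^k-y^k x y k)) (∣m⇒∣m*n (y ^ k) ∣-refl))
    where
    expand : ∀ x y X Y → x * (X - Y) + (x - y) * Y ≡ x * X - y * Y
    expand = solve-∀

  fermatsLittleTheorem-pos : ∀ {p} → Prime p → ∀ a → + p ∣ᶻ (+ a) ^ p - + a
  fermatsLittleTheorem-pos {p} pp a with fermatsLittleTheorem-ℕ pp a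
  ... | m , p∣m , a^p≡m+a = subst (+ p ∣ᶻ_) +m≡a^p-a (∣ᵤ⇒∣ p∣m)
    where
    open ≡-Reasoning
    m≡[m+a]-a : ∀ m a → m ≡ (m + a) - a
    m≡[m+a]-a = solve-∀
    +m≡a^p-a : + m ≡ (+ a) ^ p - + a
    +m≡a^p-a = begin
      + m                ≡⟨ m≡[m+a]-a (+ m) (+ a) ⟩
      (+ m + + a) - + a  ≡⟨ cong (_- + a) (pos-+ m a) ⟨
      + (m ℕ.+ a) - + a  ≡⟨ cong (λ t → + t - + a) a^p≡m+a ⟨
      + (a ℕ.^ p) - + a  ≡⟨ cong (_- + a) (pos-^ a p) ⟩
      (+ a) ^ p - + a    ∎

  fermatsLittleTheorem : ∀ {p} → Prime p → ∀ x → + p ∣ᶻ x ^ p - x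
  fermatsLittleTheorem {p} pp x = subst (+ p ∣ᶻ_) (regroup x r (x ^ p) (r ^ p))
    (∣m∣n⇒∣m-n (∣m∣n⇒∣m+n (∣-trans p∣x-r (x-y∣x^k-y^k x r p)) (fermatsLittleTheorem-pos pp (x %ℕ p))) p∣x-r)
    where
    instance _ = prime⇒nonZero pp
    r : ℤ
    r = + (x %ℕ p)
    cancel : ∀ r s → (r + s) - r ≡ s
    cancel = solve-∀
    p∣x-r : + p ∣ᶻ x - r
    p∣x-r = divides (x /ℕ p) (trans (cong (_- r) (a≡a%ℕn+[a/ℕn]*n x p)) (cancel r ((x /ℕ p) * + p)))
    regroup : ∀ x r X R → (X - R) + (R - r) - (x - r) ≡ X - x
    regroup = solve-∀

  fermatsLittleTheorem-iterated : ∀ {s} → Prime (suc s) → ∀ t x → + suc s ∣ᶻ x ^ suc (t ℕ.* s) - x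
  fermatsLittleTheorem-iterated pℓ zero x = divides 0ℤ (x*1-x≡0 x)
    where
    x*1-x≡0 : ∀ x → x * 1ℤ - x ≡ 0ℤ
    x*1-x≡0 = solve-∀
  fermatsLittleTheorem-iterated {s} pℓ (suc t) x = subst (+ suc s ∣ᶻ_) x^[ℓ+ts]-x≡
    (∣m∣n⇒∣m+n (∣m⇒∣m*n (x ^ (t ℕ.* s)) (fermatsLittleTheorem pℓ x)) (fermatsLittleTheorem-iterated pℓ t x))
    where
    split : ∀ x X Y → (X - x) * Y + (x * Y - x) ≡ X * Y - x
    split = solve-∀
    x^[ℓ+ts]-x≡ : (x ^ suc s - x) * x ^ (t ℕ.* s) + (x ^ suc (t ℕ.* s) - x) ≡ x ^ suc (suc t ℕ.* s) - x
    x^[ℓ+ts]-x≡ = trans (split x (x ^ suc s) (x ^ (t ℕ.* s)))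
                        (cong (_- x) (sym (^-distribˡ-+-* x (suc s) (t ℕ.* s))))

  fermatsLittleTheorem-generalised : ∀ {ℓ q} → Prime ℓ → (ℓ ∸ 1) ∣ q → ∀ x → + ℓ ∣ᶻ x ^ suc q - x
  fermatsLittleTheorem-generalised {suc s} pℓ (ℕ.divides t refl) = fermatsLittleTheorem-iterated pℓ t

  euclidsLemmaᶻ : ∀ {p} → Prime p → ∀ x y → + p ∣ᶻ x * y → (+ p ∣ᶻ x) ⊎ (+ p ∣ᶻ y)
  euclidsLemmaᶻ {p} pp x y p∣xy =
    map ∣ᵤ⇒∣ ∣ᵤ⇒∣ (euclidsLemma ∣ x ∣ ∣ y ∣ pp (subst (p ∣_) (abs-* x y) (∣⇒∣ᵤ p∣xy)))

  prime∣^⇒∣ : ∀ {p x} → Prime p → ∀ k → + p ∣ᶻ x ^ k → + p ∣ᶻ x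
  prime∣^⇒∣ pp zero    p∣1      = ⊥-elim (¬prime[1] (subst Prime (ℕ.∣1⇒≡1 (∣⇒∣ᵤ p∣1)) pp))
  prime∣^⇒∣ pp (suc k) p∣x^1+k = [ id , prime∣^⇒∣ pp k ]′ (euclidsLemmaᶻ pp _ _ p∣x^1+k)

  prime∣²⇒∣ : ∀ {p} → Prime p → ∀ x → + p ∣ᶻ x * x → + p ∣ᶻ x
  prime∣²⇒∣ pp x p∣x² = [ id , id ]′ (euclidsLemmaᶻ pp x x p∣x²)

module ClearedDenominators where

  open import Data.Nat as ℕ using (suc)
  open import Data.Integer using (ℤ; +_; _+_; _-_; _*_; _^_)
  open import Data.Integer.Properties using (*-assoc)
  open import Data.Integer.Divisibility.Signed
    using (_∣?_; ∣m∣n⇒∣m+n; ∣m∣n⇒∣m-n; ∣m⇒∣m*n; ∣n⇒∣m*n) renaming (_∣_ to _∣ᶻ_)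
  open import Data.Integer.Tactic.RingSolver using (solve-∀)
  open import Data.Sum using ([_,_]′)
  open import Function using (id)
  open import Relation.Nullary using (¬_; contradiction; yes; no)
  open import Relation.Binary.PropositionalEquality
  open FermatInt using (euclidsLemmaᶻ; prime∣^⇒∣; prime∣²⇒∣)

  -- For x = n / d these are d^p · numγ p x and d^(2p) · denγ p x.
  numγᶻ : ℕ → ℤ → ℤ → ℤ
  numγᶻ p n d = n ^ p - n * d ^ (p ∸ 1)

  denγᶻ : ℕ → ℤ → ℤ → ℤ
  denγᶻ p n d = numγᶻ p n d * numγᶻ p n d - d ^ p * d ^ p

  ∣numγᶻ*d : ∀ {ℓ} q → (∀ x → + ℓ ∣ᶻ x ^ suc q - x) → ∀ n d → + ℓ ∣ᶻ numγᶻ (suc q) n d * d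
  ∣numγᶻ*d {ℓ} q fermat n d = subst (+ ℓ ∣ᶻ_) (regroup n d (n ^ suc q) (d ^ q))
    (∣m∣n⇒∣m-n (∣m⇒∣m*n d (fermat n)) (∣n⇒∣m*n n (fermat d)))
    where
    regroup : ∀ n d A B → (A - n) * d - n * (d * B - d) ≡ (A - n * B) * d
    regroup = solve-∀

  ∣numγᶻ*d^p : ∀ {ℓ} q → (∀ x → + ℓ ∣ᶻ x ^ suc q - x) → ∀ n d → + ℓ ∣ᶻ numγᶻ (suc q) n d * d ^ suc q
  ∣numγᶻ*d^p {ℓ} q fermat n d =
    subst (+ ℓ ∣ᶻ_) (*-assoc (numγᶻ (suc q) n d) d (d ^ q)) (∣m⇒∣m*n (d ^ q) (∣numγᶻ*d q fermat n d))

  a-b+b≡a : ∀ a b → a - b + b ≡ a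
  a-b+b≡a = solve-∀

  a-[a-b]≡b : ∀ a b → a - (a - b) ≡ b
  a-[a-b]≡b = solve-∀

  ∤d⇒∤denγᶻ : ∀ {ℓ} p {n d} → Prime ℓ → ¬ (+ ℓ ∣ᶻ d) → + ℓ ∣ᶻ numγᶻ p n d * d → ¬ (+ ℓ ∣ᶻ denγᶻ p n d)
  ∤d⇒∤denγᶻ {ℓ} p {n} {d} pℓ ℓ∤d ℓ∣N*d ℓ∣E = ℓ∤d (prime∣^⇒∣ pℓ p (prime∣²⇒∣ pℓ D ℓ∣D*D))
    where
    N D : ℤ
    N = numγᶻ p n d
    D = d ^ p
    ℓ∣N : + ℓ ∣ᶻ N
    ℓ∣N = [ id , (λ ℓ∣d → contradiction ℓ∣d ℓ∤d) ]′ (euclidsLemmaᶻ pℓ N d ℓ∣N*d)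
    ℓ∣D*D : + ℓ ∣ᶻ D * D
    ℓ∣D*D = subst (+ ℓ ∣ᶻ_) (a-[a-b]≡b (N * N) (D * D)) (∣m∣n⇒∣m-n (∣m⇒∣m*n N ℓ∣N) ℓ∣E)

  -- Here p = 2 + q, since ℓ ∣ d has to give ℓ ∣ d^(p-1).
  ∣d⇒∤denγᶻ : ∀ {ℓ} q {n d} → Prime ℓ → ¬ (+ ℓ ∣ᶻ n) → + ℓ ∣ᶻ d → ¬ (+ ℓ ∣ᶻ denγᶻ (2 ℕ.+ q) n d)
  ∣d⇒∤denγᶻ {ℓ} q {n} {d} pℓ ℓ∤n ℓ∣d ℓ∣E = ℓ∤n (prime∣^⇒∣ pℓ p ℓ∣n^p)
    where
    p : ℕ
    p = 2 ℕ.+ q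
    N D : ℤ
    N = numγᶻ p n d
    D = d ^ p
    ℓ∣D : + ℓ ∣ᶻ D
    ℓ∣D = ∣m⇒∣m*n _ ℓ∣d
    ℓ∣N : + ℓ ∣ᶻ N
    ℓ∣N = prime∣²⇒∣ pℓ N (subst (+ ℓ ∣ᶻ_) (a-b+b≡a (N * N) (D * D)) (∣m∣n⇒∣m+n ℓ∣E (∣m⇒∣m*n D ℓ∣D)))
    ℓ∣n^p : + ℓ ∣ᶻ n ^ p
    ℓ∣n^p = subst (+ ℓ ∣ᶻ_) (a-b+b≡a (n ^ p) _) (∣m∣n⇒∣m+n ℓ∣N (∣n⇒∣m*n n (∣m⇒∣m*n _ ℓ∣d)))

  ∤denγᶻ : ∀ {ℓ} q {n d} → Prime ℓ → (+ ℓ ∣ᶻ n → ¬ (+ ℓ ∣ᶻ d)) → + ℓ ∣ᶻ numγᶻ (2 ℕ.+ q) n d * d →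
           ¬ (+ ℓ ∣ᶻ denγᶻ (2 ℕ.+ q) n d)
  ∤denγᶻ {ℓ} q {n} {d} pℓ coprime ℓ∣N*d with + ℓ ∣? d
  ... | yes ℓ∣d = ∣d⇒∤denγᶻ q pℓ (λ ℓ∣n → coprime ℓ∣n ℓ∣d) ℓ∣d
  ... | no  ℓ∤d = ∤d⇒∤denγᶻ (2 ℕ.+ q) {n} pℓ ℓ∤d ℓ∣N*d

module RationalArithmetic where

  open import Data.Nat as ℕ using (zero; suc)
  open import Data.Integer as ℤ using (ℤ; +_)
  import Data.Integer.Properties as ℤ
  open import Data.Integer.GCD using (gcd)
  open import Data.Integer.Tactic.RingSolver as ℤ using ()
  open import Data.Rational using (_/_; _*_; _+_; -_; _-_; 1/_; toℚᵘ; ↥_; ↧_; ↧ₙ_; ≢-nonZero)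
  open import Data.Rational.Properties
    using (toℚᵘ-injective; toℚᵘ-fromℚᵘ; toℚᵘ-homo-+; toℚᵘ-homo-*; toℚᵘ-homo‿-; p≡0⇒↥p≡0; ↥-/; ↥p/↧p≡p;
           *-inverseʳ; *-identityʳ; *-assoc; +-*-commutativeRing)
  open import Data.Rational.Unnormalised as ℚᵘ using (mkℚᵘ; *≡*)
  import Data.Rational.Unnormalised.Properties as ℚᵘ
  open import Data.Maybe using (nothing)
  open import Tactic.RingSolver.Core.AlmostCommutativeRing using (AlmostCommutativeRing; fromCommutativeRing)
  open import Relation.Binary.PropositionalEquality

  ℚ-ring : AlmostCommutativeRing _ _
  ℚ-ring = fromCommutativeRing +-*-commutativeRing (λ _ → nothing)

  fromℤ : ℤ → ℚ
  fromℤ z = z / 1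

  toℚᵘ-fromℤ : ∀ z → toℚᵘ (fromℤ z) ℚᵘ.≃ mkℚᵘ z 0
  toℚᵘ-fromℤ z = toℚᵘ-fromℚᵘ (mkℚᵘ z 0)

  fromℤ-+ : ∀ a b → fromℤ (a ℤ.+ b) ≡ fromℤ a + fromℤ b
  fromℤ-+ a b = toℚᵘ-injective (begin
    toℚᵘ (fromℤ (a ℤ.+ b))               ≈⟨ toℚᵘ-fromℤ (a ℤ.+ b) ⟩
    mkℚᵘ (a ℤ.+ b) 0                     ≈⟨ *≡* (eq a b) ⟩
    mkℚᵘ a 0 ℚᵘ.+ mkℚᵘ b 0               ≈⟨ ℚᵘ.+-cong (toℚᵘ-fromℤ a) (toℚᵘ-fromℤ b) ⟨
    toℚᵘ (fromℤ a) ℚᵘ.+ toℚᵘ (fromℤ b)   ≈⟨ toℚᵘ-homo-+ (fromℤ a) (fromℤ b) ⟨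
    toℚᵘ (fromℤ a + fromℤ b)             ∎)
    where
    open ℚᵘ.≃-Reasoning
    eq : ∀ a b → (a ℤ.+ b) ℤ.* + 1 ≡ (a ℤ.* + 1 ℤ.+ b ℤ.* + 1) ℤ.* + 1
    eq = ℤ.solve-∀

  fromℤ-* : ∀ a b → fromℤ (a ℤ.* b) ≡ fromℤ a * fromℤ b
  fromℤ-* a b = toℚᵘ-injective (begin
    toℚᵘ (fromℤ (a ℤ.* b))               ≈⟨ toℚᵘ-fromℤ (a ℤ.* b) ⟩
    mkℚᵘ a 0 ℚᵘ.* mkℚᵘ b 0               ≈⟨ ℚᵘ.*-cong (toℚᵘ-fromℤ a) (toℚᵘ-fromℤ b) ⟨
    toℚᵘ (fromℤ a) ℚᵘ.* toℚᵘ (fromℤ b)   ≈⟨ toℚᵘ-homo-* (fromℤ a) (fromℤ b) ⟨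
    toℚᵘ (fromℤ a * fromℤ b)             ∎)
    where open ℚᵘ.≃-Reasoning

  fromℤ-neg : ∀ a → fromℤ (ℤ.- a) ≡ - fromℤ a
  fromℤ-neg a = toℚᵘ-injective (begin
    toℚᵘ (fromℤ (ℤ.- a))     ≈⟨ toℚᵘ-fromℤ (ℤ.- a) ⟩
    ℚᵘ.- mkℚᵘ a 0           ≈⟨ ℚᵘ.-‿cong (toℚᵘ-fromℤ a) ⟨
    ℚᵘ.- toℚᵘ (fromℤ a)     ≈⟨ toℚᵘ-homo‿- (fromℤ a) ⟨
    toℚᵘ (- fromℤ a)        ∎)
    where open ℚᵘ.≃-Reasoning

  fromℤ-- : ∀ a b → fromℤ (a ℤ.- b) ≡ fromℤ a - fromℤ b
  fromℤ-- a b = trans (fromℤ-+ a (ℤ.- b)) (cong (λ t → fromℤ a + t) (fromℤ-neg b))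

  fromℤ-^ : ∀ z k → fromℤ (z ℤ.^ k) ≡ fromℤ z ^ℚ k
  fromℤ-^ z zero    = refl
  fromℤ-^ z (suc k) = trans (fromℤ-* z (z ℤ.^ k)) (cong (fromℤ z *_) (fromℤ-^ z k))

  fromℤ-≢0 : ∀ {z} → z ≢ + 0 → fromℤ z ≢ 0ℚ
  fromℤ-≢0 {z} z≢0 z/1≡0 = z≢0 (begin
    z                  ≡⟨ ↥-/ z 1 ⟨
    ↥ (fromℤ z) ℤ.* g  ≡⟨ cong (ℤ._* g) (p≡0⇒↥p≡0 (fromℤ z) z/1≡0) ⟩
    + 0 ℤ.* g          ≡⟨ ℤ.*-zeroˡ g ⟩
    + 0                ∎)
    where
    open ≡-Reasoning
    g : ℤ
    g = gcd z (+ 1)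

  /-*-fromℤ : ∀ z b .{{_ : ℕ.NonZero b}} → (z / b) * fromℤ (+ b) ≡ fromℤ z
  /-*-fromℤ z (suc m) = toℚᵘ-injective (begin
    toℚᵘ ((z / suc m) * fromℤ (+ suc m))
      ≈⟨ toℚᵘ-homo-* (z / suc m) (fromℤ (+ suc m)) ⟩
    toℚᵘ (z / suc m) ℚᵘ.* toℚᵘ (fromℤ (+ suc m))
      ≈⟨ ℚᵘ.*-cong (toℚᵘ-fromℚᵘ (mkℚᵘ z m)) (toℚᵘ-fromℤ (+ suc m)) ⟩
    mkℚᵘ z m ℚᵘ.* mkℚᵘ (+ suc m) 0
      ≈⟨ *≡* (eq z (+ suc m)) ⟩
    mkℚᵘ z 0
      ≈⟨ toℚᵘ-fromℤ z ⟨
    toℚᵘ (fromℤ z) ∎)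
    where
    open ℚᵘ.≃-Reasoning
    eq : ∀ z s → (z ℤ.* s) ℤ.* + 1 ≡ z ℤ.* (s ℤ.* + 1)
    eq = ℤ.solve-∀

  *-↧≡↥ : ∀ x → x * fromℤ (↧ x) ≡ fromℤ (↥ x)
  *-↧≡↥ x = trans (cong (_* fromℤ (↧ x)) (sym (↥p/↧p≡p x))) (/-*-fromℤ (↥ x) (↧ₙ x))

  *-cancelʳ-≡ : ∀ {u v} c → c ≢ 0ℚ → u * c ≡ v * c → u ≡ v
  *-cancelʳ-≡ {u} {v} c c≢0 uc≡vc = begin
    u                ≡⟨ x≡x*c*c⁻¹ u ⟩
    u * c * 1/ c     ≡⟨ cong (_* 1/ c) uc≡vc ⟩
    v * c * 1/ c     ≡⟨ x≡x*c*c⁻¹ v ⟨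
    v                ∎
    where
    open ≡-Reasoning
    instance _ = ≢-nonZero c≢0
    x≡x*c*c⁻¹ : ∀ x → x ≡ x * c * 1/ c
    x≡x*c*c⁻¹ x = sym (trans (*-assoc x c (1/ c)) (trans (cong (x *_) (*-inverseʳ c)) (*-identityʳ x)))

module Scaling where

  open import Data.Nat as ℕ using (zero; suc)
  open import Data.Integer as ℤ using (ℤ; +_)
  open import Data.Rational using (_/_; _*_; _-_; 1/_; 1ℚ; ≢-nonZero)
  open import Data.Rational.Properties using (*-inverseʳ; *-identityˡ)
  open import Tactic.RingSolver using (solve-∀)
  open import Relation.Binary.PropositionalEquality
  open ClearedDenominators using (numγᶻ; denγᶻ)
  open RationalArithmetic

  ^ℚ-scaled : ∀ x c {m} k → x * c ≡ m → x ^ℚ k * c ^ℚ k ≡ m ^ℚ k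
  ^ℚ-scaled x c zero    _    = refl
  ^ℚ-scaled x c (suc k) xc≡m = trans (interchange x (x ^ℚ k) c (c ^ℚ k)) (cong₂ _*_ xc≡m (^ℚ-scaled x c k xc≡m))
    where
    interchange : ∀ a b c d → (a * b) * (c * d) ≡ (a * c) * (b * d)
    interchange = solve-∀ ℚ-ring

  numγ-scaled : ∀ q x n d → x * fromℤ d ≡ fromℤ n →
                numγ (suc q) x * fromℤ (d ℤ.^ suc q) ≡ fromℤ (numγᶻ (suc q) n d)
  numγ-scaled q x n d xd≡n = begin
    numγ p x * fromℤ (d ℤ.^ p)                         ≡⟨ cong (numγ p x *_) (fromℤ-^ d p) ⟩
    (x ^ℚ p - x) * (c * c ^ℚ q)                        ≡⟨ expand (x ^ℚ p) x c (c ^ℚ q) ⟩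
    x ^ℚ p * c ^ℚ p - (x * c) * c ^ℚ q                 ≡⟨ cong₂ (λ u v → u - v * c ^ℚ q) (^ℚ-scaled x c p xd≡n) xd≡n ⟩
    fromℤ n ^ℚ p - fromℤ n * c ^ℚ q                    ≡⟨ cong₂ (λ u v → u - fromℤ n * v) (fromℤ-^ n p) (fromℤ-^ d q) ⟨
    fromℤ (n ℤ.^ p) - fromℤ n * fromℤ (d ℤ.^ q)        ≡⟨ cong (λ v → fromℤ (n ℤ.^ p) - v) (fromℤ-* n (d ℤ.^ q)) ⟨
    fromℤ (n ℤ.^ p) - fromℤ (n ℤ.* d ℤ.^ q)            ≡⟨ fromℤ-- (n ℤ.^ p) (n ℤ.* d ℤ.^ q) ⟨
    fromℤ (numγᶻ p n d)                                ∎
    where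
    open ≡-Reasoning
    p : ℕ
    p = suc q
    c : ℚ
    c = fromℤ d
    expand : ∀ X x c C → (X - x) * (c * C) ≡ X * (c * C) - (x * c) * C
    expand = solve-∀ ℚ-ring

  denγ-scaled : ∀ p x n d → numγ p x * fromℤ (d ℤ.^ p) ≡ fromℤ (numγᶻ p n d) →
                denγ p x * fromℤ (d ℤ.^ p ℤ.* d ℤ.^ p) ≡ fromℤ (denγᶻ p n d)
  denγ-scaled p x n d yD≡N = begin
    (y * y - 1ℚ) * fromℤ (D ℤ.* D)          ≡⟨ cong ((y * y - 1ℚ) *_) (fromℤ-* D D) ⟩
    (y * y - 1ℚ) * (c * c)                  ≡⟨ expand y c ⟩
    (y * c) * (y * c) - c * c               ≡⟨ cong (λ u → u * u - c * c) yD≡N ⟩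
    fromℤ N * fromℤ N - c * c               ≡⟨ cong₂ _-_ (fromℤ-* N N) (fromℤ-* D D) ⟨
    fromℤ (N ℤ.* N) - fromℤ (D ℤ.* D)       ≡⟨ fromℤ-- (N ℤ.* N) (D ℤ.* D) ⟨
    fromℤ (denγᶻ p n d)                     ∎
    where
    open ≡-Reasoning
    N D : ℤ
    N = numγᶻ p n d
    D = d ℤ.^ p
    y c : ℚ
    y = numγ p x
    c = fromℤ D
    expand : ∀ y c → (y * y - 1ℚ) * (c * c) ≡ (y * c) * (y * c) - c * c
    expand = solve-∀ ℚ-ring

  γ-scaled : ∀ {q} (pp : Prime (suc q)) x (h : denγ (suc q) x ≢ 0ℚ) n d → x * fromℤ d ≡ fromℤ n →
             γ (suc q) pp x h * fromℤ (+ suc q ℤ.* denγᶻ (suc q) n d) ≡ fromℤ (numγᶻ (suc q) n d ℤ.* d ℤ.^ suc q)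
  γ-scaled {q} pp x h n d xd≡n = begin
    (P * (y * I)) * fromℤ (+ p ℤ.* E)        ≡⟨ cong ((P * (y * I)) *_) pE≡ ⟩
    (P * (y * I)) * (p̂ * (den * (c * c)))    ≡⟨ regroup P y I p̂ den c ⟩
    ((P * p̂) * (den * I)) * ((y * c) * c)    ≡⟨ cong₂ (λ u v → u * (v * c)) P*p̂*[den*I]≡1 yc≡N ⟩
    (1ℚ * 1ℚ) * (fromℤ N * c)                ≡⟨ *-identityˡ (fromℤ N * c) ⟩
    fromℤ N * c                              ≡⟨ fromℤ-* N (d ℤ.^ p) ⟨
    fromℤ (N ℤ.* d ℤ.^ p)                    ∎
    where
    open ≡-Reasoning
    instance _ = ≢-nonZero h
    p : ℕ
    p = suc q
    P p̂ y den I c : ℚ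
    P = (+ 1) / p
    p̂ = fromℤ (+ p)
    y = numγ p x
    den = denγ p x
    I = 1/ den
    c = fromℤ (d ℤ.^ p)
    N E : ℤ
    N = numγᶻ p n d
    E = denγᶻ p n d
    yc≡N : y * c ≡ fromℤ N
    yc≡N = numγ-scaled q x n d xd≡n
    den*c²≡E : den * (c * c) ≡ fromℤ E
    den*c²≡E = trans (cong (den *_) (sym (fromℤ-* (d ℤ.^ p) (d ℤ.^ p)))) (denγ-scaled p x n d yc≡N)
    pE≡ : fromℤ (+ p ℤ.* E) ≡ p̂ * (den * (c * c))
    pE≡ = trans (fromℤ-* (+ p) E) (cong (p̂ *_) (sym den*c²≡E))
    P*p̂*[den*I]≡1 : (P * p̂) * (den * I) ≡ 1ℚ * 1ℚ
    P*p̂*[den*I]≡1 = cong₂ _*_ (/-*-fromℤ (+ 1) p) (*-inverseʳ den)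
    regroup : ∀ P y I p̂ den c → (P * (y * I)) * (p̂ * (den * (c * c))) ≡ ((P * p̂) * (den * I)) * ((y * c) * c)
    regroup = solve-∀ ℚ-ring

module Localisation where

  import Data.Nat as ℕ
  import Data.Nat.Divisibility as ℕ
  open import Data.Nat.Primality using (¬prime[1]; euclidsLemma)
  import Data.Nat.Coprimality as Coprimality
  open import Data.Integer as ℤ using (ℤ; +_; -[1+_]; ∣_∣)
  import Data.Integer.Properties as ℤ
  open import Data.Integer.Divisibility.Signed using (divides; ∣⇒∣ᵤ; ∣ᵤ⇒∣) renaming (_∣_ to _∣ᶻ_)
  open import Data.Rational using (mkℚ; _/_; _*_; ↥_; ↧_)
  open import Data.Rational.Properties using (*-assoc)
  open import Data.Product using (∃-syntax; _×_; _,_)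
  open import Data.Sum using ([_,_]′)
  open import Function using (id)
  open import Relation.Nullary using (¬_)
  open import Relation.Binary.PropositionalEquality
  open import Tactic.RingSolver using (solve-∀)
  open RationalArithmetic

  +∣w∣*∣w∣≡w*w : ∀ w → + (∣ w ∣ ℕ.* ∣ w ∣) ≡ w ℤ.* w
  +∣w∣*∣w∣≡w*w (+ n)    = ℤ.pos-* n n
  +∣w∣*∣w∣≡w*w -[1+ n ] = refl

  ∤⇒≢0 : ∀ {k w} → ¬ (k ∣ᶻ w) → w ≢ + 0
  ∤⇒≢0 {k} k∤0 refl = k∤0 (divides (+ 0) (sym (ℤ.*-zeroˡ k)))

  -- The witness is z w / |w|², whose denominator is a natural number.
  quotient∈ℤ₍ℓ₎ : ∀ {ℓ w} → Prime ℓ → ¬ (+ ℓ ∣ᶻ w) → ∀ z → ∃[ r ] InZloc ℓ r × r * fromℤ w ≡ fromℤ z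
  quotient∈ℤ₍ℓ₎ {ℓ} {w} pℓ ℓ∤w z = r , (z ℤ.* w , b , b≢0 , ℓ∤b , refl) ,
    *-cancelʳ-≡ (fromℤ w) (fromℤ-≢0 (∤⇒≢0 ℓ∤w)) (begin
      r * fromℤ w * fromℤ w          ≡⟨ *-assoc r (fromℤ w) (fromℤ w) ⟩
      r * (fromℤ w * fromℤ w)        ≡⟨ cong (r *_) w²≡b ⟩
      r * fromℤ (+ b)                ≡⟨ /-*-fromℤ (z ℤ.* w) b ⟩
      fromℤ (z ℤ.* w)                ≡⟨ fromℤ-* z w ⟩
      fromℤ z * fromℤ w              ∎)
    where
    open ≡-Reasoning
    b : ℕ
    b = ∣ w ∣ ℕ.* ∣ w ∣
    ℓ∤b : ¬ (ℓ ℕ.∣ b)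
    ℓ∤b ℓ∣b = ℓ∤w (∣ᵤ⇒∣ ([ id , id ]′ (euclidsLemma ∣ w ∣ ∣ w ∣ pℓ ℓ∣b)))
    instance
      b≢0 : ℕ.NonZero b
      b≢0 = ℕ.≢-nonZero (λ b≡0 → ℓ∤b (subst (ℓ ℕ.∣_) (sym b≡0) (ℓ ℕ.∣0)))
    r : ℚ
    r = (z ℤ.* w) / b
    w²≡b : fromℤ w * fromℤ w ≡ fromℤ (+ b)
    w²≡b = trans (sym (fromℤ-* w w)) (cong fromℤ (sym (+∣w∣*∣w∣≡w*w w)))

  ∈ℓℤ₍ℓ₎ : ∀ {ℓ w z y} → Prime ℓ → ¬ (+ ℓ ∣ᶻ w) → + ℓ ∣ᶻ z → y * fromℤ w ≡ fromℤ z → InℓZloc ℓ y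
  ∈ℓℤ₍ℓ₎ {ℓ} {w} {z} {y} pℓ ℓ∤w (divides k z≡kℓ) yw≡z with quotient∈ℤ₍ℓ₎ pℓ ℓ∤w k
  ... | r , r∈ℤ₍ℓ₎ , rw≡k = r , r∈ℤ₍ℓ₎ , *-cancelʳ-≡ (fromℤ w) (fromℤ-≢0 (∤⇒≢0 ℓ∤w)) (begin
    y * fromℤ w                    ≡⟨ yw≡z ⟩
    fromℤ z                        ≡⟨ cong fromℤ z≡kℓ ⟩
    fromℤ (k ℤ.* + ℓ)              ≡⟨ fromℤ-* k (+ ℓ) ⟩
    fromℤ k * fromℤ (+ ℓ)          ≡⟨ cong (_* fromℤ (+ ℓ)) rw≡k ⟨
    r * fromℤ w * fromℤ (+ ℓ)      ≡⟨ rotate r (fromℤ w) (fromℤ (+ ℓ)) ⟩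
    fromℤ (+ ℓ) * r * fromℤ w      ∎)
    where
    open ≡-Reasoning
    rotate : ∀ a b c → a * b * c ≡ c * a * b
    rotate = solve-∀ ℚ-ring

  ∣↥⇒∤↧ : ∀ {ℓ} → Prime ℓ → ∀ x → + ℓ ∣ᶻ ↥ x → ¬ (+ ℓ ∣ᶻ ↧ x)
  ∣↥⇒∤↧ pℓ (mkℚ n e c) ℓ∣n ℓ∣d = ¬prime[1] (subst Prime (Coprimality.recompute c (∣⇒∣ᵤ ℓ∣n , ∣⇒∣ᵤ ℓ∣d)) pℓ)

open import Data.Nat as ℕ using (suc)
open import Data.Nat.Primality using (¬prime[0]; ¬prime[1])
open import Data.Integer as ℤ using (ℤ; +_)
open import Data.Integer.Divisibility.Signed using (∣⇒∣ᵤ) renaming (_∣_ to _∣ᶻ_)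
open import Data.Rational using (↥_; ↧_)
open import Data.Sum using ([_,_]′)
open import Data.Empty using (⊥-elim)
open import Relation.Nullary using (¬_)
open import Function using (_∘_)
open import Relation.Binary.PropositionalEquality using (≢-sym)
open FermatNat using (prime∤prime)
open FermatInt using (fermatsLittleTheorem-generalised; euclidsLemmaᶻ)
open ClearedDenominators using (numγᶻ; denγᶻ; ∣numγᶻ*d; ∣numγᶻ*d^p; ∤denγᶻ)
open RationalArithmetic using (*-↧≡↥)
open Scaling using (γ-scaled)
open Localisation using (∈ℓℤ₍ℓ₎; ∣↥⇒∤↧)

lemma2p9 : (p ℓ : ℕ) → (pp : Prime p) → Prime ℓ → p ≢ ℓ →
    (ℓ ∸ 1) ∣ (p ∸ 1) →
    (x : ℚ) → (h : denγ p x ≢ 0ℚ) → InℓZloc ℓ (γ p pp x h)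
lemma2p9 0                 _ pp _  _   _         _ _ = ⊥-elim (¬prime[0] pp)
lemma2p9 1                 _ pp _  _   _         _ _ = ⊥-elim (¬prime[1] pp)
lemma2p9 p@(suc (suc q))   ℓ pp pℓ p≢ℓ ℓ-1∣p-1 x h =
  ∈ℓℤ₍ℓ₎ pℓ ℓ∤p*E (∣numγᶻ*d^p (suc q) fermat n d) (γ-scaled pp x h n d (*-↧≡↥ x))
  where
  n d : ℤ
  n = ↥ x
  d = ↧ x
  fermat : ∀ z → + ℓ ∣ᶻ z ℤ.^ p ℤ.- z
  fermat = fermatsLittleTheorem-generalised pℓ ℓ-1∣p-1
  ℓ∤p : ¬ (+ ℓ ∣ᶻ + p)
  ℓ∤p = prime∤prime pℓ pp (≢-sym p≢ℓ) ∘ ∣⇒∣ᵤ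
  ℓ∤E : ¬ (+ ℓ ∣ᶻ denγᶻ p n d)
  ℓ∤E = ∤denγᶻ q pℓ (∣↥⇒∤↧ pℓ x) (∣numγᶻ*d (suc q) fermat n d)
  ℓ∤p*E : ¬ (+ ℓ ∣ᶻ + p ℤ.* denγᶻ p n d)
  ℓ∤p*E = [ ℓ∤p , ℓ∤E ]′ ∘ euclidsLemmaᶻ pℓ (+ p) (denγᶻ p n d)
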